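{- Let $\mathcal C,F$ and $\mathcal D,G$ be arbitrary pointed simplicial models and $\mathcal M,w$ and $\mathcal N,v$ arbitrary pointed local epistemic models. Then $\mathcal C,F$ and $\mathcal D,G$ are bisimilar iff $\mathtt{LEM}(\mathcal C),F$ and $\mathtt{LEM}(\mathcal D),G$ are bisimilar; and $\mathcal M,w$ and $\mathcal N,v$ are bisimilar iff $\mathtt{SC}(\mathcal M),F^{\mathcal M}_w$ and $\mathtt{SC}(\mathcal N),F^{\mathcal N}_v$ are bisimilar.
   Context: Fix a nonempty finite set $\mathbf{A}$ of agents and a countable set $\mathbf{P}$ of predicate letters. Simplicial model: $\mathcal{C}=(\mathcal{V},C,\chi,\ell)$ with $\mathcal{V}\neq\emptyset$, $C\subseteq\wp(\mathcal V)$, $\emptyset\notin C$, $C$ closed under nonempty subsets, all singletons in $C$, $\chi:\mathcal V\to\mathbf A$ injective on each face, $\ell:\mathbf P\to\wp(\mathcal V)$; facets $\mathcal F(C)$ are maximal faces; a pointed simplicial model is a pair with a facet. First-order Kripke model: $\mathcal{M}=(W,\delta,\{R_a\}_{a\in\mathbf A},\rho)$ with $W\neq\emptyset$, $\delta:W\to\wp(\mathbf A)\setminus\{\emptyset\}$, $R_a\subseteq W\times W$ with $R_a(w)=\emptyset$ if $a\notin\delta(w)$, $\rho:\mathbf P\times W\to\wp(\mathbf A)$, $\rho(p,w)\subseteq\delta(w)$. Local epistemic model: a first-order Kripke model with (Local S5) each $R_a$ restricted to $\{w\mid a\in\delta(w)\}$ is an equivalence relation; (Individually Increasing Domain) $a\in\delta(w)$,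 $wR_av$ imply $a\in\delta(v)$; (Local Predicates) $a\in\rho(p,w)$, $wR_av$ imply $a\in\rho(p,v)$; (Collectively Decreasing Domain) $v\in\bigcap_{a\in\delta(w)}R_a(w)$ implies $\delta(v)\subseteq\delta(w)$. $\mathtt{LEM}(\mathcal C)$: worlds $\mathcal F(C)$, $\delta(F)=\chi[F]$, $R_a=\{(F,G)\mid a\in\chi[F\cap G]\}$, $\rho(p,F)=\chi[F\cap\ell(p)]$. $\mathtt{SC}(\mathcal M)$: with $[w]_a=R_a(w)$ and $F^{\mathcal M}_w=\{(a,[w]_a)\mid a\in\delta(w)\}$, vertices $\{(a,[w]_a)\mid w\in W,a\in\delta(w)\}$, faces the nonempty subsets of some $F^{\mathcal M}_w$, coloring $(a,[w]_a)\mapsto a$, $\ell(p)=\{(a,[w]_a)\mid a\in\rho(p,w)\}$; its facets are exactly the sets $F^{\mathcal M}_w$. Bisimulation between simplicial models $\mathcal C,\mathcal D$: $Z\subseteq\mathcal{F}(C^{\mathcal C})\times\mathcal{F}(C^{\mathcal D})$ such that for all $(F,G)\in Z$: (Inv) $\chi^{\mathcal C}[F]=\chi^{\mathcal D}[G]$ and $\chi^{\mathcal C}[F\cap\ell^{\mathcal C}(p)]=\chi^{\mathcal D}[G\cap\ell^{\mathcal D}(p)]$ for all $p$; (Zig) for all $A\subseteq\mathbf A$, $F'$ with $A\subseteq\chi^{\mathcal C}[F\cap F']$ there is $G'$ with $A\subseteq\chi^{\mathcal D}[G\cap G']$ and $(F',G')\in Z$; (Zag) symmetrically. Bisimulation between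 first-order Kripke models: $Z\subseteq W^{\mathcal M}\times W^{\mathcal N}$ such that for all $(w,v)\in Z$: $\delta^{\mathcal M}(w)=\delta^{\mathcal N}(v)$, $\rho^{\mathcal M}(p,w)=\rho^{\mathcal N}(p,v)$ for all $p$; for all $A\subseteq\mathbf A$ and $w'\in\bigcap_{a\in A}R^{\mathcal M}_a(w)$ there is $v'\in\bigcap_{a\in A}R^{\mathcal N}_a(v)$ with $(w',v')\in Z$; and symmetrically. Pointed models are bisimilar if some bisimulation relates their points. -}

module Defs where

open import Level using (Level; _⊔_; 0ℓ) renaming (suc to lsuc)
open import Data.Nat using (ℕ; suc)
open import Data.Fin using (Fin)
open import Data.Fin.Subset using (Subset) renaming (_∈_ to _∈ₛ_)
open import Data.Product using (Σ; ∃; _×_; _,_; proj₁)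
open import Relation.Binary.PropositionalEquality using (_≡_)
open import Relation.Unary using (Pred; _⊆_; _≐_; Satisfiable; _∩_; _∈_)

Agent : ℕ → Set
Agent n = Fin (suc n)

record SimplicialModel (n : ℕ) (Pr : Set) (ℓ : Level) : Set (lsuc ℓ) where
  field
    V   : Set ℓ
    C   : Pred V ℓ → Set ℓ
    χ   : V → Agent n
    lab : Pr → Pred V ℓ

module _ {n : ℕ} {Pr : Set} {ℓ : Level} (𝒞 : SimplicialModel n Pr ℓ) where
  open SimplicialModel 𝒞

  record IsSimplicialModel : Set (lsuc ℓ) where
    field
      nonemptyV   : V
      emptyNotFace : ∀ F → C F → Satisfiable F
      downClosed  : ∀ F G → C F → G ⊆ F → Satisfiable G → C G
      singletons  : ∀ x → C (λ y → y ≡ x)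
      χ-injective : ∀ F → C F → ∀ x y → x ∈ F → y ∈ F → χ x ≡ χ y → x ≡ y

  IsFacet : Pred V ℓ → Set (lsuc ℓ)
  IsFacet F = C F × (∀ G → C G → F ⊆ G → G ⊆ F)

  χ[_] : Pred V ℓ → Pred (Agent n) ℓ
  χ[ X ] a = ∃ λ x → x ∈ X × χ x ≡ a

record KripkeModel (n : ℕ) (Pr : Set) (ℓw ℓr : Level) : Set (lsuc (ℓw ⊔ ℓr)) where
  field
    W : Set ℓw
    δ : W → Pred (Agent n) ℓr
    R : Agent n → W → W → Set ℓr
    ρ : Pr → W → Pred (Agent n) ℓr

module _ {n : ℕ} {Pr : Set} {ℓw ℓr : Level} (ℳ : KripkeModel n Pr ℓw ℓr) where
  open KripkeModel ℳ

  record IsFOKripkeModel : Set (ℓw ⊔ ℓr) where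
    field
      nonemptyW : W
      δ-nonempty : ∀ w → Satisfiable (δ w)
      R-domain   : ∀ a w v → R a w v → a ∈ δ w
      ρ-domain   : ∀ p w → ρ p w ⊆ δ w

  record IsLocalEpistemicModel : Set (ℓw ⊔ ℓr) where
    field
      isFOKripke : IsFOKripkeModel
      S5-refl  : ∀ a w → a ∈ δ w → R a w w
      S5-sym   : ∀ a w v → a ∈ δ w → a ∈ δ v → R a w v → R a v w
      S5-trans : ∀ a w v u → a ∈ δ w → a ∈ δ v → a ∈ δ u →
                 R a w v → R a v u → R a w u
      incDomain : ∀ a w v → a ∈ δ w → R a w v → a ∈ δ v
      localPred : ∀ p a w v → a ∈ ρ p w → R a w v → a ∈ ρ p v
      decDomain : ∀ w v → (∀ a → a ∈ δ w → R a w v) → δ v ⊆ δ w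

LEM : ∀ {n Pr ℓ} → SimplicialModel n Pr ℓ → KripkeModel n Pr (lsuc ℓ) ℓ
LEM {ℓ = ℓ} 𝒞 = record
  { W = Σ (Pred V ℓ) (IsFacet 𝒞)
  ; δ = λ F → χ[_] 𝒞 (proj₁ F)
  ; R = λ a F G → χ[_] 𝒞 (proj₁ F ∩ proj₁ G) a
  ; ρ = λ p F → χ[_] 𝒞 (proj₁ F ∩ lab p)
  }
  where open SimplicialModel 𝒞

-- The vertex (a,[w]_a) is represented by a triple (a , w , a∈δw);
-- two such triples denote the same vertex iff the agents agree and the
-- classes R_a(w) coincide (as sets); all predicates below are phrased
-- via equality of classes, hence invariant under this identification.

module _ {n : ℕ} {Pr : Set} {ℓ : Level} (ℳ : KripkeModel n Pr ℓ ℓ) where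
  open KripkeModel ℳ

  SCVertex : Set ℓ
  SCVertex = Σ (Agent n) λ a → Σ W λ w → a ∈ δ w

  -- F^ℳ_w = {(a,[w]_a) | a ∈ δ(w)}
  Fw : W → Pred SCVertex ℓ
  Fw w (b , u , _) = ∃ λ (_ : b ∈ δ w) → R b w ≐ R b u

  SC : SimplicialModel n Pr ℓ
  SC = record
    { V   = SCVertex
    ; C   = λ G → Satisfiable G × ∃ λ w → G ⊆ Fw w
    ; χ   = proj₁
    ; lab = λ p (b , u , _) → ∃ λ w → b ∈ ρ p w × (b ∈ δ w) × (R b w ≐ R b u)
    }

module _ {n : ℕ} {Pr : Set} {ℓ : Level}
         (𝒞 𝒟 : SimplicialModel n Pr ℓ) where
  private
    module C = SimplicialModel 𝒞
    module D = SimplicialModel 𝒟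

  IsSBisimulation : (Pred C.V ℓ → Pred D.V ℓ → Set (lsuc ℓ)) → Set (lsuc ℓ)
  IsSBisimulation Z = ∀ F G → Z F G →
      IsFacet 𝒞 F × IsFacet 𝒟 G
    × (χ[_] 𝒞 F ≐ χ[_] 𝒟 G)
    × (∀ p → χ[_] 𝒞 (F ∩ C.lab p) ≐ χ[_] 𝒟 (G ∩ D.lab p))
    × (∀ (A : Subset (suc n)) F' → IsFacet 𝒞 F' →
         (∀ a → a ∈ₛ A → χ[_] 𝒞 (F ∩ F') a) →
         ∃ λ G' → IsFacet 𝒟 G' × (∀ a → a ∈ₛ A → χ[_] 𝒟 (G ∩ G') a) × Z F' G')
    × (∀ (A : Subset (suc n)) G' → IsFacet 𝒟 G' →
         (∀ a → a ∈ₛ A → χ[_] 𝒟 (G ∩ G') a) →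
         ∃ λ F' → IsFacet 𝒞 F' × (∀ a → a ∈ₛ A → χ[_] 𝒞 (F ∩ F') a) × Z F' G')

  SBisimilar : Pred C.V ℓ → Pred D.V ℓ → Set (lsuc (lsuc ℓ))
  SBisimilar F G = Σ (Pred C.V ℓ → Pred D.V ℓ → Set (lsuc ℓ)) λ Z →
    IsSBisimulation Z × Z F G

module _ {n : ℕ} {Pr : Set} {ℓw ℓr : Level} (ℓz : Level)
         (ℳ 𝒩 : KripkeModel n Pr ℓw ℓr) where
  private
    module M = KripkeModel ℳ
    module N = KripkeModel 𝒩

  IsKBisimulation : (M.W → N.W → Set ℓz) → Set (ℓw ⊔ ℓr ⊔ ℓz)
  IsKBisimulation Z = ∀ w v → Z w v →
      (M.δ w ≐ N.δ v)
    × (∀ p → M.ρ p w ≐ N.ρ p v)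
    × (∀ (A : Subset (suc n)) w' → (∀ a → a ∈ₛ A → M.R a w w') →
         ∃ λ v' → (∀ a → a ∈ₛ A → N.R a v v') × Z w' v')
    × (∀ (A : Subset (suc n)) v' → (∀ a → a ∈ₛ A → N.R a v v') →
         ∃ λ w' → (∀ a → a ∈ₛ A → M.R a w w') × Z w' v')

  KBisimilar : M.W → N.W → Set (lsuc ℓz ⊔ ℓw ⊔ ℓr)
  KBisimilar w v = Σ (M.W → N.W → Set ℓz) λ Z → IsKBisimulation Z × Z w v

-- A bisimulation between simplicial models is a relation on facets, and the facets of 𝒞 are
-- exactly the worlds of LEM(𝒞), with δ, ρ and R_a read off from colours of intersections;
-- so bisimulations of simplicial models and of their LEMs are literally the same relations.
-- Conversely, in a local epistemic model the facets of SC(ℳ) are, up to extensional equality,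
-- exactly the sets F_w, and χ[F_w] = δ(w), χ[F_w ∩ ℓ(p)] = ρ(p,w), χ[F_w ∩ F_w'] = {a | w R_a w'};
-- hence a bisimulation on one side transfers to the other by relating w with F_w.
module Submission where

open import Defs
open import Level using (Level; _⊔_) renaming (suc to lsuc)
open import Data.Nat using (ℕ; suc)
open import Data.Fin.Subset using (Subset) renaming (_∈_ to _∈ₛ_)
open import Data.Product using (_×_; _,_; proj₁; proj₂; Σ; ∃)
open import Relation.Unary using (Pred; _⊆_; _≐_; _∩_; _∈_)
open import Relation.Unary.Properties using (≐-refl; ≐-sym; ≐-trans)
open import Relation.Binary.PropositionalEquality using (refl)
open import Function.Bundles using (_↣_; _⇔_; mk⇔)

∩-cong : ∀ {a ℓ} {A : Set a} {P P′ Q Q′ : Pred A ℓ} → P ≐ P′ → Q ≐ Q′ → P ∩ Q ≐ P′ ∩ Q′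
∩-cong (P⊆P′ , P′⊆P) (Q⊆Q′ , Q′⊆Q) =
  (λ (p , q) → P⊆P′ p , Q⊆Q′ q) , (λ (p , q) → P′⊆P p , Q′⊆Q q)

≐-transport : ∀ {a ℓ} {A : Set a} {P P′ Q Q′ : Pred A ℓ} → P ≐ P′ → Q ≐ Q′ → P′ ≐ Q′ → P ≐ Q
≐-transport P≐P′ Q≐Q′ P′≐Q′ = ≐-trans P≐P′ (≐-trans P′≐Q′ (≐-sym Q≐Q′))

module _ {n : ℕ} {Pr : Set} {ℓ : Level} (𝒞 : SimplicialModel n Pr ℓ) where
  open SimplicialModel 𝒞

  χ[]-mono : {X Y : Pred V ℓ} → X ⊆ Y → χ[_] 𝒞 X ⊆ χ[_] 𝒞 Y
  χ[]-mono X⊆Y (x , x∈X , χx≡a) = x , X⊆Y x∈X , χx≡a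

  χ[]-cong : {X Y : Pred V ℓ} → X ≐ Y → χ[_] 𝒞 X ≐ χ[_] 𝒞 Y
  χ[]-cong (X⊆Y , Y⊆X) = χ[]-mono X⊆Y , χ[]-mono Y⊆X

-- The back clause of a relation Z is, definitionally, the forth clause of its converse.
module _ {n : ℕ} {Pr : Set} {ℓ ℓz : Level} (𝒞 𝒟 : SimplicialModel n Pr ℓ) where
  private
    module C = SimplicialModel 𝒞
    module D = SimplicialModel 𝒟

  SForth : (Pred C.V ℓ → Pred D.V ℓ → Set ℓz) → Pred C.V ℓ → Pred D.V ℓ → Set (lsuc ℓ ⊔ ℓz)
  SForth Z F G = ∀ (A : Subset (suc n)) F′ → IsFacet 𝒞 F′ →
    (∀ a → a ∈ₛ A → χ[_] 𝒞 (F ∩ F′) a) →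
    ∃ λ G′ → IsFacet 𝒟 G′ × (∀ a → a ∈ₛ A → χ[_] 𝒟 (G ∩ G′) a) × Z F′ G′

  SForth-mono : ∀ {Z Z′ : Pred C.V ℓ → Pred D.V ℓ → Set ℓz} {F G} →
    (∀ {F′ G′} → Z F′ G′ → Z′ F′ G′) → SForth Z F G → SForth Z′ F G
  SForth-mono Z⇒Z′ forth A F′ F′-facet h =
    let (G′ , G′-facet , h′ , z) = forth A F′ F′-facet h in G′ , G′-facet , h′ , Z⇒Z′ z

module _ {n : ℕ} {Pr : Set} {ℓw ℓr ℓz : Level} (ℳ 𝒩 : KripkeModel n Pr ℓw ℓr) where
  private
    module M = KripkeModel ℳ
    module N = KripkeModel 𝒩

  KForth : (M.W → N.W → Set ℓz) → M.W → N.W → Set (ℓw ⊔ ℓr ⊔ ℓz)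
  KForth Z w v = ∀ (A : Subset (suc n)) w′ → (∀ a → a ∈ₛ A → M.R a w w′) →
    ∃ λ v′ → (∀ a → a ∈ₛ A → N.R a v v′) × Z w′ v′

  KForth-mono : ∀ {Z Z′ : M.W → N.W → Set ℓz} {w v} →
    (∀ {w′ v′} → Z w′ v′ → Z′ w′ v′) → KForth Z w v → KForth Z′ w v
  KForth-mono Z⇒Z′ forth A w′ h = let (v′ , h′ , z) = forth A w′ h in v′ , h′ , Z⇒Z′ z

module _ {n : ℕ} {Pr : Set} {ℓ : Level} (𝒞 𝒟 : SimplicialModel n Pr ℓ) where
  private
    module C = SimplicialModel 𝒞
    module D = SimplicialModel 𝒟
    module LC = KripkeModel (LEM 𝒞)
    module LD = KripkeModel (LEM 𝒟)

  OnFacets : (LC.W → LD.W → Set (lsuc ℓ)) → Pred C.V ℓ → Pred D.V ℓ → Set (lsuc ℓ)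
  OnFacets Z F G = Σ (IsFacet 𝒞 F) λ pF → Σ (IsFacet 𝒟 G) λ pG → Z (F , pF) (G , pG)

  SForth⇒LEM-KForth : ∀ {Z : Pred C.V ℓ → Pred D.V ℓ → Set (lsuc ℓ)} {x y} →
    SForth 𝒞 𝒟 Z (proj₁ x) (proj₁ y) →
    KForth (LEM 𝒞) (LEM 𝒟) (λ x′ y′ → Z (proj₁ x′) (proj₁ y′)) x y
  SForth⇒LEM-KForth forth A (F′ , F′-facet) h =
    let (G′ , G′-facet , h′ , z) = forth A F′ F′-facet h in (G′ , G′-facet) , h′ , z

  LEM-KForth⇒SForth : ∀ {Z F G} (pF : IsFacet 𝒞 F) (pG : IsFacet 𝒟 G) →
    KForth (LEM 𝒞) (LEM 𝒟) Z (F , pF) (G , pG) → SForth 𝒞 𝒟 (OnFacets Z) F G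
  LEM-KForth⇒SForth _ _ forth A F′ F′-facet h =
    let ((G′ , G′-facet) , h′ , z) = forth A (F′ , F′-facet) h
    in G′ , G′-facet , h′ , (F′-facet , G′-facet , z)

module _ {n : ℕ} {Pr : Set} {ℓ : Level} {𝒞 𝒟 : SimplicialModel n Pr ℓ} where
  private
    module C = SimplicialModel 𝒞
    module D = SimplicialModel 𝒟
    module LC = KripkeModel (LEM 𝒞)
    module LD = KripkeModel (LEM 𝒟)

  SBisimulation⇒LEM-KBisimulation : ∀ {Z : Pred C.V ℓ → Pred D.V ℓ → Set (lsuc ℓ)} →
    IsSBisimulation 𝒞 𝒟 Z →
    IsKBisimulation (lsuc ℓ) (LEM 𝒞) (LEM 𝒟) (λ x y → Z (proj₁ x) (proj₁ y))
  SBisimulation⇒LEM-KBisimulation bis x y z =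
    let (_ , _ , χ≐ , lab≐ , zig , zag) = bis (proj₁ x) (proj₁ y) z
    in χ≐ , lab≐ , SForth⇒LEM-KForth 𝒞 𝒟 {x = x} {y} zig , SForth⇒LEM-KForth 𝒟 𝒞 {x = y} {x} zag

  LEM-KBisimulation⇒SBisimulation : ∀ {Z : LC.W → LD.W → Set (lsuc ℓ)} →
    IsKBisimulation (lsuc ℓ) (LEM 𝒞) (LEM 𝒟) Z → IsSBisimulation 𝒞 𝒟 (OnFacets 𝒞 𝒟 Z)
  LEM-KBisimulation⇒SBisimulation bis F G (pF , pG , z) =
    let (δ≐ , ρ≐ , zig , zag) = bis (F , pF) (G , pG) z
    in pF , pG , δ≐ , ρ≐ , LEM-KForth⇒SForth 𝒞 𝒟 pF pG zig ,
       SForth-mono 𝒟 𝒞 (λ (pG′ , pF′ , z′) → pF′ , pG′ , z′) (LEM-KForth⇒SForth 𝒟 𝒞 pG pF zag)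

  SBisimilar⇔LEM-KBisimilar : ∀ {F} (pF : IsFacet 𝒞 F) {G} (pG : IsFacet 𝒟 G) →
    SBisimilar 𝒞 𝒟 F G ⇔ KBisimilar (lsuc ℓ) (LEM 𝒞) (LEM 𝒟) (F , pF) (G , pG)
  SBisimilar⇔LEM-KBisimilar pF pG = mk⇔
    (λ (_ , bis , z) → _ , SBisimulation⇒LEM-KBisimulation bis , z)
    (λ (Z , bis , z) → OnFacets 𝒞 𝒟 Z , LEM-KBisimulation⇒SBisimulation bis , (pF , pG , z))

module SC-Properties {n : ℕ} {Pr : Set} {ℓ : Level}
    (ℳ : KripkeModel n Pr ℓ ℓ) (ℳ-local : IsLocalEpistemicModel ℳ) where
  open KripkeModel ℳ
  open IsLocalEpistemicModel ℳ-local
  open IsFOKripkeModel isFOKripke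
  open SimplicialModel (SC ℳ) using (lab)

  R-class-≐ : ∀ {a w w′} → a ∈ δ w → R a w w′ → R a w ≐ R a w′
  R-class-≐ {a} {w} {w′} a∈δw Rww′ =
    (λ Rwx → S5-trans a w′ w _ a∈δw′ a∈δw (incDomain a w _ a∈δw Rwx) Rw′w Rwx) ,
    (λ Rw′x → S5-trans a w w′ _ a∈δw a∈δw′ (incDomain a w′ _ a∈δw′ Rw′x) Rww′ Rw′x)
    where
    a∈δw′ = incDomain a w w′ a∈δw Rww′
    Rw′w = S5-sym a w w′ a∈δw a∈δw′ Rww′

  χ[Fw]≐δ : ∀ w → χ[_] (SC ℳ) (Fw ℳ w) ≐ δ w
  χ[Fw]≐δ w =
    (λ { (_ , (a∈δw , _) , refl) → a∈δw }) ,
    λ {a} a∈δw → (a , w , a∈δw) , (a∈δw , ≐-refl) , refl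

  χ[Fw∩lab]≐ρ : ∀ p w → χ[_] (SC ℳ) (Fw ℳ w ∩ lab p) ≐ ρ p w
  χ[Fw∩lab]≐ρ p w =
    (λ { ((a , _) , ((a∈δw , w≐x) , (u , a∈ρu , _ , u≐x)) , refl) →
           localPred p a u w a∈ρu (proj₂ u≐x (proj₁ w≐x (S5-refl a w a∈δw))) }) ,
    λ {a} a∈ρw → let a∈δw = ρ-domain p w a∈ρw in
      (a , w , a∈δw) , ((a∈δw , ≐-refl) , (w , a∈ρw , a∈δw , ≐-refl)) , refl

  χ[Fw∩Fw]≐R : ∀ w w′ → χ[_] (SC ℳ) (Fw ℳ w ∩ Fw ℳ w′) ≐ (λ a → R a w w′)
  χ[Fw∩Fw]≐R w w′ =
    (λ { ((a , _) , ((_ , w≐x) , (a∈δw′ , w′≐x)) , refl) →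
           proj₂ w≐x (proj₁ w′≐x (S5-refl a w′ a∈δw′)) }) ,
    λ {a} Rww′ → let a∈δw = R-domain a w w′ Rww′ in
      (a , w , a∈δw) ,
      ((a∈δw , ≐-refl) , (incDomain a w w′ a∈δw Rww′ , ≐-sym (R-class-≐ a∈δw Rww′))) , refl

  -- F_w ⊆ F_u makes u R_a-related to w for every a ∈ δ(w), so Collectively Decreasing Domain
  -- gives δ(u) ⊆ δ(w).
  Fw-maximal : ∀ {w u} → Fw ℳ w ⊆ Fw ℳ u → Fw ℳ u ⊆ Fw ℳ w
  Fw-maximal {w} {u} w⊆u {b , _} (b∈δu , u≐x) = b∈δw , ≐-trans (≐-sym (u≐w b∈δw)) u≐x
    where
    u≐w : ∀ {a} (a∈δw : a ∈ δ w) → R a u ≐ R a w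
    u≐w {a} a∈δw = proj₂ (w⊆u {a , w , a∈δw} (a∈δw , ≐-refl))
    δu⊆δw : δ u ⊆ δ w
    δu⊆δw = decDomain w u λ a a∈δw →
      proj₁ (u≐w a∈δw) (S5-refl a u (proj₁ (w⊆u {a , w , a∈δw} (a∈δw , ≐-refl))))
    b∈δw = δu⊆δw b∈δu

  Fw-isFacet : ∀ w → IsFacet (SC ℳ) (Fw ℳ w)
  Fw-isFacet w =
    (((a , w , a∈δw) , a∈δw , ≐-refl) , w , λ x → x) ,
    λ { G (_ , u , G⊆u) w⊆G {x} x∈G →
        Fw-maximal {w} {u} (λ {y} y∈Fw → G⊆u (w⊆G {y} y∈Fw)) {x} (G⊆u x∈G) }
    where
    a = proj₁ (δ-nonempty w)
    a∈δw = proj₂ (δ-nonempty w)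

  facet-≐Fw : ∀ {F} → IsFacet (SC ℳ) F → ∃ λ w → F ≐ Fw ℳ w
  facet-≐Fw ((_ , w , F⊆w) , F-max) = w , F⊆w , F-max (Fw ℳ w) (proj₁ (Fw-isFacet w)) F⊆w

  module _ {F : Pred (SCVertex ℳ) ℓ} {w : W} (F≐w : F ≐ Fw ℳ w) where

    ≐Fw⇒isFacet : IsFacet (SC ℳ) F
    ≐Fw⇒isFacet =
      let (((v , v∈w) , _) , w-max) = Fw-isFacet w
          (F⊆w , w⊆F) = F≐w
      in ((v , w⊆F {v} v∈w) , w , F⊆w) ,
         λ G G-face F⊆G {x} x∈G → w⊆F {x} (w-max G G-face (λ {y} y∈w → F⊆G (w⊆F {y} y∈w)) x∈G)

    ≐Fw⇒χ≐δ : χ[_] (SC ℳ) F ≐ δ w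
    ≐Fw⇒χ≐δ = ≐-trans (χ[]-cong (SC ℳ) F≐w) (χ[Fw]≐δ w)

    ≐Fw⇒χ∩lab≐ρ : ∀ p → χ[_] (SC ℳ) (F ∩ lab p) ≐ ρ p w
    ≐Fw⇒χ∩lab≐ρ p = ≐-trans (χ[]-cong (SC ℳ) (∩-cong F≐w ≐-refl)) (χ[Fw∩lab]≐ρ p w)

    ≐Fw⇒χ∩≐R : ∀ {F′ w′} → F′ ≐ Fw ℳ w′ → χ[_] (SC ℳ) (F ∩ F′) ≐ (λ a → R a w w′)
    ≐Fw⇒χ∩≐R {w′ = w′} F′≐w′ = ≐-trans (χ[]-cong (SC ℳ) (∩-cong F≐w F′≐w′)) (χ[Fw∩Fw]≐R w w′)

module _ {n : ℕ} {Pr : Set} {ℓ : Level} {ℳ 𝒩 : KripkeModel n Pr ℓ ℓ}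
    (ℳ-local : IsLocalEpistemicModel ℳ) (𝒩-local : IsLocalEpistemicModel 𝒩) where
  private
    module M = SC-Properties ℳ ℳ-local
    module N = SC-Properties 𝒩 𝒩-local
    Wℳ = KripkeModel.W ℳ
    W𝒩 = KripkeModel.W 𝒩

  OnSCFacets : (Wℳ → W𝒩 → Set (lsuc ℓ)) → Pred (SCVertex ℳ) ℓ → Pred (SCVertex 𝒩) ℓ → Set (lsuc ℓ)
  OnSCFacets Z F G = Σ Wℳ λ w → Σ W𝒩 λ v → F ≐ Fw ℳ w × G ≐ Fw 𝒩 v × Z w v

  OnWorlds : (Pred (SCVertex ℳ) ℓ → Pred (SCVertex 𝒩) ℓ → Set (lsuc ℓ)) → Wℳ → W𝒩 → Set (lsuc ℓ)
  OnWorlds Z w v = Σ (Pred (SCVertex ℳ) ℓ) λ F → Σ (Pred (SCVertex 𝒩) ℓ) λ G →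
    F ≐ Fw ℳ w × G ≐ Fw 𝒩 v × Z F G

  KForth⇒SC-SForth : ∀ {Z F G w v} → F ≐ Fw ℳ w → G ≐ Fw 𝒩 v →
    KForth ℳ 𝒩 Z w v → SForth (SC ℳ) (SC 𝒩) (OnSCFacets Z) F G
  KForth⇒SC-SForth F≐w G≐v forth A F′ F′-facet h =
    let (w′ , F′≐w′) = M.facet-≐Fw F′-facet
        (v′ , Rvv′ , z) = forth A w′ λ a a∈A → proj₁ (M.≐Fw⇒χ∩≐R F≐w F′≐w′) (h a a∈A)
    in Fw 𝒩 v′ , N.Fw-isFacet v′ ,
       (λ a a∈A → proj₂ (N.≐Fw⇒χ∩≐R G≐v ≐-refl) (Rvv′ a a∈A)) ,
       (w′ , v′ , F′≐w′ , ≐-refl , z)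

  SC-SForth⇒KForth : ∀ {Z F G w v} → F ≐ Fw ℳ w → G ≐ Fw 𝒩 v →
    SForth (SC ℳ) (SC 𝒩) Z F G → KForth ℳ 𝒩 (OnWorlds Z) w v
  SC-SForth⇒KForth F≐w G≐v forth A w′ Rww′ =
    let (G′ , G′-facet , h , z) = forth A (Fw ℳ w′) (M.Fw-isFacet w′) λ a a∈A →
                                    proj₂ (M.≐Fw⇒χ∩≐R F≐w ≐-refl) (Rww′ a a∈A)
        (v′ , G′≐v′) = N.facet-≐Fw G′-facet
    in v′ , (λ a a∈A → proj₁ (N.≐Fw⇒χ∩≐R G≐v G′≐v′) (h a a∈A)) ,
       (Fw ℳ w′ , G′ , ≐-refl , G′≐v′ , z)

module _ {n : ℕ} {Pr : Set} {ℓ : Level} {ℳ 𝒩 : KripkeModel n Pr ℓ ℓ}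
    (ℳ-local : IsLocalEpistemicModel ℳ) (𝒩-local : IsLocalEpistemicModel 𝒩) where
  private
    module M = SC-Properties ℳ ℳ-local
    module N = SC-Properties 𝒩 𝒩-local

  KBisimulation⇒SC-SBisimulation : ∀ {Z} → IsKBisimulation (lsuc ℓ) ℳ 𝒩 Z →
    IsSBisimulation (SC ℳ) (SC 𝒩) (OnSCFacets ℳ-local 𝒩-local Z)
  KBisimulation⇒SC-SBisimulation bis F G (w , v , F≐w , G≐v , z) =
    let (δ≐ , ρ≐ , forth , back) = bis w v z
    in M.≐Fw⇒isFacet F≐w , N.≐Fw⇒isFacet G≐v ,
       ≐-transport (M.≐Fw⇒χ≐δ F≐w) (N.≐Fw⇒χ≐δ G≐v) δ≐ ,
       (λ p → ≐-transport (M.≐Fw⇒χ∩lab≐ρ F≐w p) (N.≐Fw⇒χ∩lab≐ρ G≐v p) (ρ≐ p)) ,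
       KForth⇒SC-SForth ℳ-local 𝒩-local F≐w G≐v forth ,
       SForth-mono (SC 𝒩) (SC ℳ) (λ (v′ , w′ , G′≐v′ , F′≐w′ , z′) → w′ , v′ , F′≐w′ , G′≐v′ , z′)
         (KForth⇒SC-SForth 𝒩-local ℳ-local G≐v F≐w back)

  SC-SBisimulation⇒KBisimulation : ∀ {Z} → IsSBisimulation (SC ℳ) (SC 𝒩) Z →
    IsKBisimulation (lsuc ℓ) ℳ 𝒩 (OnWorlds ℳ-local 𝒩-local Z)
  SC-SBisimulation⇒KBisimulation bis w v (F , G , F≐w , G≐v , z) =
    let (_ , _ , χ≐ , lab≐ , zig , zag) = bis F G z
    in ≐-transport (≐-sym (M.≐Fw⇒χ≐δ F≐w)) (≐-sym (N.≐Fw⇒χ≐δ G≐v)) χ≐ ,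
       (λ p → ≐-transport (≐-sym (M.≐Fw⇒χ∩lab≐ρ F≐w p)) (≐-sym (N.≐Fw⇒χ∩lab≐ρ G≐v p)) (lab≐ p)) ,
       SC-SForth⇒KForth ℳ-local 𝒩-local F≐w G≐v zig ,
       KForth-mono 𝒩 ℳ (λ (G′ , F′ , G′≐v′ , F′≐w′ , z′) → F′ , G′ , F′≐w′ , G′≐v′ , z′)
         (SC-SForth⇒KForth 𝒩-local ℳ-local G≐v F≐w zag)

  KBisimilar⇔SC-SBisimilar : ∀ w v →
    KBisimilar (lsuc ℓ) ℳ 𝒩 w v ⇔ SBisimilar (SC ℳ) (SC 𝒩) (Fw ℳ w) (Fw 𝒩 v)
  KBisimilar⇔SC-SBisimilar w v = mk⇔
    (λ (Z , bis , z) → OnSCFacets ℳ-local 𝒩-local Z , KBisimulation⇒SC-SBisimulation bis ,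
                       (w , v , ≐-refl , ≐-refl , z))
    (λ (Z , bis , z) → OnWorlds ℳ-local 𝒩-local Z , SC-SBisimulation⇒KBisimulation bis ,
                       (Fw ℳ w , Fw 𝒩 v , ≐-refl , ≐-refl , z))

mainTheorem6 : (n : ℕ) (Pr : Set) → Pr ↣ ℕ → {ℓ : Level} →
    ((𝒞 𝒟 : SimplicialModel n Pr ℓ) →
      IsSimplicialModel 𝒞 → IsSimplicialModel 𝒟 →
      (F : Pred (SimplicialModel.V 𝒞) ℓ) (pF : IsFacet 𝒞 F) →
      (G : Pred (SimplicialModel.V 𝒟) ℓ) (pG : IsFacet 𝒟 G) →
      SBisimilar 𝒞 𝒟 F G ⇔ KBisimilar (lsuc ℓ) (LEM 𝒞) (LEM 𝒟) (F , pF) (G , pG))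
  × ((ℳ 𝒩 : KripkeModel n Pr ℓ ℓ) →
      IsLocalEpistemicModel ℳ → IsLocalEpistemicModel 𝒩 →
      (w : KripkeModel.W ℳ) (v : KripkeModel.W 𝒩) →
      KBisimilar (lsuc ℓ) ℳ 𝒩 w v ⇔ SBisimilar (SC ℳ) (SC 𝒩) (Fw ℳ w) (Fw 𝒩 v))
mainTheorem6 _ _ _ =
  (λ _ _ _ _ _ pF _ pG → SBisimilar⇔LEM-KBisimilar pF pG) ,
  (λ _ _ ℳ-local 𝒩-local → KBisimilar⇔SC-SBisimilar ℳ-local 𝒩-local)
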